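{- Let $b\in\mathbb{Q}$ with $b\neq 0$ and let $\phi(z)=z+\frac{b}{z}\in\mathbb{Q}(z)$. Then the number of points of $\mathbb{P}^1(\mathbb{Q})$ that are preperiodic for $\phi$ is $2$, $4$, or $6$.
   Context: A point $P$ is preperiodic for $\phi$ if $\phi^n(P)=\phi^m(P)$ for some integers $n>m\ge0$, where $\phi^n$ is the $n$-th iterate. -}

module Defs where

open import Data.Nat using (ℕ; _<_)
open import Data.Maybe using (Maybe; just; nothing)
open import Data.Product using (∃₂; _×_)
open import Data.Rational using (ℚ; 0ℚ; _+_; _÷_; ≢-nonZero)
open import Data.Rational.Properties using (_≟_)
open import Relation.Nullary using (yes; no)
open import Relation.Binary.PropositionalEquality using (_≡_)

-- The projective line P¹(ℚ): 'just z' is the affine point z, 'nothing' is ∞.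
ℙ¹ℚ : Set
ℙ¹ℚ = Maybe ℚ

φ : ℚ → ℙ¹ℚ → ℙ¹ℚ
φ b nothing = nothing
φ b (just z) with z ≟ 0ℚ
... | yes _ = nothing
... | no z≢0 = just (z + (_÷_ b z {{≢-nonZero z≢0}}))

iter : {A : Set} → (A → A) → ℕ → A → A
iter f ℕ.zero x = x
iter f (ℕ.suc n) x = f (iter f n x)

Preperiodic : {A : Set} → (A → A) → A → Set
Preperiodic f P = ∃₂ λ n m → (m < n) × (iter f n P ≡ iter f m P)

-- The map π(z) = -z²/b semiconjugates φ to the b-independent map ψ(u) = u + 1/u - 2 = (u - 1)²/u.
-- If u = x/y in lowest terms then ψ(u) = (x - y)²/(xy) is again in lowest terms, so along a
-- ψ-orbit the denominator never decreases, and over two steps it grows strictly unless the orbit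
-- meets S = {∞, 0, 1, 1/2, 2}.  Since ψ⁻¹(S) ⊆ S (a preimage of a point of S has height at most 2),
-- every ψ-preperiodic point lies in S.  Hence the φ-preperiodic points are ∞, 0 and the z with
-- z² ∈ {-b, -b/2, -2b}, and all of these are preperiodic: z ↦ 0 ↦ ∞, the 2-cycle z ↔ -z, and
-- z ↦ z/2 into that cycle.  As √2 is irrational, -b and -b/2 are not both squares, while -b/2
-- and -2b are squares simultaneously; so there are 2, 2 + 2 or 2 + 4 preperiodic points.

module Submission where

open import Defs
open import Data.Nat as ℕ using (ℕ; zero; suc; z≤n; s≤s)
import Data.Nat.Properties as ℕP
open import Data.Nat.Divisibility using (divides; ∣-antisym; ∣-trans; ∣1⇒≡1)
open import Data.Nat.Coprimality as Coprimality using (Coprime; coprime-divisor)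
open import Data.Integer as ℤ using (ℤ; +_; -[1+_])
import Data.Integer.Properties as ℤP
open import Data.Integer.Divisibility.Signed using (_∣_; ∣ᵤ⇒∣; ∣⇒∣ᵤ; ∣m∣n⇒∣m+n; ∣m∣n⇒∣m-n)
import Data.Integer.Tactic.RingSolver as ℤ-Solver
open import Data.Rational as ℚ
  using (ℚ; mkℚ; 0ℚ; 1ℚ; ½; _+_; _*_; _-_; -_; 1/_; _÷_; ↥_; ↧_; ↧ₙ_; ≢-nonZero; NonZero)
open import Data.Rational.Properties as ℚP using (_≟_; +-*-commutativeRing)
import Data.Rational.Unnormalised as ℚᵘ
import Data.Rational.Unnormalised.Properties as ℚᵘP
open import Data.Product using (_,_; _×_; Σ; ∃; ∃₂; proj₁; proj₂; uncurry)
open import Data.Sum as Sum using (_⊎_; inj₁; inj₂; [_,_]′; fromInj₂; reduce)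
open import Data.Sum.Function.Propositional using (_⊎-⇔_)
open import Data.Empty using (⊥-elim)
open import Data.Unit using (⊤; tt)
open import Data.Maybe using (Maybe; just; nothing)
open import Data.Maybe.Properties using (just-injective)
open import Data.List using (List; []; _∷_; _++_; map; length)
open import Data.List.Membership.Propositional using (_∈_)
open import Data.List.Membership.Propositional.Properties
  using (∈-++⁺ˡ; ∈-++⁺ʳ; ∈-++⁻; ∈-map⁺; ∈-map⁻)
open import Data.List.Relation.Binary.Disjoint.Propositional using (Disjoint)
open import Data.List.Relation.Unary.Any using (here; there)
open import Data.List.Relation.Unary.All using ([]; _∷_; tabulate)
open import Data.List.Relation.Unary.AllPairs using ([]; _∷_)
open import Data.List.Relation.Unary.Unique.Propositional using (Unique)
open import Data.List.Relation.Unary.Unique.Propositional.Properties using (++⁺; map⁺)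
open import Function using (_∘_)
open import Function.Bundles using (_⇔_; mk⇔; Equivalence)
open import Function.Construct.Composition using (_⇔-∘_)
open import Relation.Nullary using (yes; no; ¬_; Dec)
open import Relation.Nullary.Decidable using (map′; _⊎-dec_; False; toWitnessFalse; decidable-stable)
open import Relation.Binary.PropositionalEquality
open import Tactic.RingSolver using (solve-∀)
open import Tactic.RingSolver.Core.AlmostCommutativeRing using (AlmostCommutativeRing; fromCommutativeRing)
open ≡-Reasoning
open Equivalence using (to; from)

2ℚ : ℚ
2ℚ = 1ℚ + 1ℚ

ℚ-ring : AlmostCommutativeRing _ _
ℚ-ring = fromCommutativeRing +-*-commutativeRing 0≟
  where
  0≟ : ∀ x → Maybe (0ℚ ≡ x)
  0≟ x with 0ℚ ≟ x
  ... | yes p = just p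
  ... | no _  = nothing

*-cancelˡ-≢0 : ∀ p {q r} → p ≢ 0ℚ → p * q ≡ p * r → q ≡ r
*-cancelˡ-≢0 p {q} {r} p≢0 eq = begin
  q                ≡⟨ sym (ℚP.*-identityˡ q) ⟩
  1ℚ * q           ≡⟨ cong (_* q) (sym (ℚP.*-inverseˡ p)) ⟩
  (1/ p * p) * q   ≡⟨ ℚP.*-assoc (1/ p) p q ⟩
  1/ p * (p * q)   ≡⟨ cong (1/ p *_) eq ⟩
  1/ p * (p * r)   ≡⟨ sym (ℚP.*-assoc (1/ p) p r) ⟩
  (1/ p * p) * r   ≡⟨ cong (_* r) (ℚP.*-inverseˡ p) ⟩
  1ℚ * r           ≡⟨ ℚP.*-identityˡ r ⟩
  r                ∎
  where instance _ = ≢-nonZero p≢0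

p*q≡1⇒1/p≡q : ∀ p q .{{_ : NonZero p}} → p * q ≡ 1ℚ → 1/ p ≡ q
p*q≡1⇒1/p≡q p q pq≡1 = begin
  1/ p              ≡⟨ sym (ℚP.*-identityʳ (1/ p)) ⟩
  1/ p * 1ℚ         ≡⟨ cong (1/ p *_) (sym pq≡1) ⟩
  1/ p * (p * q)    ≡⟨ sym (ℚP.*-assoc (1/ p) p q) ⟩
  (1/ p * p) * q    ≡⟨ cong (_* q) (ℚP.*-inverseˡ p) ⟩
  1ℚ * q            ≡⟨ ℚP.*-identityˡ q ⟩
  q                 ∎

p*q≡0⇒p≡0⊎q≡0 : ∀ p q → p * q ≡ 0ℚ → p ≡ 0ℚ ⊎ q ≡ 0ℚ
p*q≡0⇒p≡0⊎q≡0 p q pq≡0 with p ≟ 0ℚ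
... | yes p≡0 = inj₁ p≡0
... | no  p≢0 = inj₂ (*-cancelˡ-≢0 p p≢0 (trans pq≡0 (sym (ℚP.*-zeroʳ p))))

p*q≢0 : ∀ {p q} → p ≢ 0ℚ → q ≢ 0ℚ → p * q ≢ 0ℚ
p*q≢0 {p} {q} p≢0 q≢0 = [ p≢0 , q≢0 ]′ ∘ p*q≡0⇒p≡0⊎q≡0 p q

p-q≡0⇒p≡q : ∀ p q → p - q ≡ 0ℚ → p ≡ q
p-q≡0⇒p≡q p q p-q≡0 = begin
  p             ≡⟨ lemma p q ⟩
  (p - q) + q   ≡⟨ cong (_+ q) p-q≡0 ⟩
  0ℚ + q        ≡⟨ ℚP.+-identityˡ q ⟩
  q             ∎
  where
  lemma : ∀ p q → p ≡ (p - q) + q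
  lemma = solve-∀ ℚ-ring

p*p≡q*q⇒p≡q⊎p≡-q : ∀ p q → p * p ≡ q * q → p ≡ q ⊎ p ≡ - q
p*p≡q*q⇒p≡q⊎p≡-q p q p²≡q² =
  Sum.map (p-q≡0⇒p≡q p q) (p-q≡0⇒p≡q p (- q)) (p*q≡0⇒p≡0⊎q≡0 (p - q) (p - - q) factored)
  where
  difference-of-squares : ∀ p q → (p - q) * (p - - q) ≡ p * p - q * q
  difference-of-squares = solve-∀ ℚ-ring
  factored : (p - q) * (p - - q) ≡ 0ℚ
  factored = begin
    (p - q) * (p - - q) ≡⟨ difference-of-squares p q ⟩
    p * p - q * q       ≡⟨ cong (_- q * q) p²≡q² ⟩
    q * q - q * q       ≡⟨ ℚP.+-inverseʳ (q * q) ⟩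
    0ℚ                  ∎

p≡-p⇒p≡0 : ∀ {p} → p ≡ - p → p ≡ 0ℚ
p≡-p⇒p≡0 {p} p≡-p = fromInj₂ (λ ()) (p*q≡0⇒p≡0⊎q≡0 2ℚ p 2p≡0)
  where
  double : ∀ p → 2ℚ * p ≡ p + p
  double = solve-∀ ℚ-ring
  2p≡0 : 2ℚ * p ≡ 0ℚ
  2p≡0 = trans (double p) (trans (cong (λ q → p + q) p≡-p) (ℚP.+-inverseʳ p))

fromℤ : ℤ → ℚ
fromℤ i = mkℚ i 0 (λ {d} (_ , d∣1) → ∣1⇒≡1 d∣1)

fromℤ-injective : ∀ {i j} → fromℤ i ≡ fromℤ j → i ≡ j
fromℤ-injective = cong ↥_

fromℤ-* : ∀ i j → fromℤ (i ℤ.* j) ≡ fromℤ i * fromℤ j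
fromℤ-* i j = ℚP.toℚᵘ-injective (ℚᵘP.≃-sym (ℚP.toℚᵘ-homo-* (fromℤ i) (fromℤ j)))

fromℤ-+ : ∀ i j → fromℤ (i ℤ.+ j) ≡ fromℤ i + fromℤ j
fromℤ-+ i j = ℚP.toℚᵘ-injective (ℚᵘP.≃-sym
  (ℚᵘP.≃-trans (ℚP.toℚᵘ-homo-+ (fromℤ i) (fromℤ j)) (ℚᵘ.*≡* (lemma i j))))
  where
  lemma : ∀ i j → (i ℤ.* + 1 ℤ.+ j ℤ.* + 1) ℤ.* + 1 ≡ (i ℤ.+ j) ℤ.* + 1
  lemma = ℤ-Solver.solve-∀

fromℤ-neg : ∀ i → fromℤ (ℤ.- i) ≡ - fromℤ i
fromℤ-neg i = ℚP.toℚᵘ-injective (ℚᵘP.≃-sym (ℚP.toℚᵘ-homo‿- (fromℤ i)))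

fromℤ-- : ∀ i j → fromℤ (i ℤ.- j) ≡ fromℤ i - fromℤ j
fromℤ-- i j = trans (fromℤ-+ i (ℤ.- j)) (cong (λ r → fromℤ i + r) (fromℤ-neg j))

p*↧p≡↥p : ∀ p → p * fromℤ (↧ p) ≡ fromℤ (↥ p)
p*↧p≡↥p p@(mkℚ n d _) = ℚP.toℚᵘ-injective
  (ℚᵘP.≃-trans (ℚP.toℚᵘ-homo-* p (fromℤ (↧ p))) (ℚᵘ.*≡* (lemma n (+ suc d))))
  where
  lemma : ∀ n e → (n ℤ.* e) ℤ.* + 1 ≡ n ℤ.* (e ℤ.* + 1)
  lemma = ℤ-Solver.solve-∀

numerator-coprime : ∀ p → Coprime ℤ.∣ ↥ p ∣ (↧ₙ p)
numerator-coprime (mkℚ _ _ c) = Coprimality.recompute c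

numerator-nonZero : ∀ {q} → q ≢ 0ℚ → ℕ.NonZero ℤ.∣ ↥ q ∣
numerator-nonZero {q} q≢0 = ℕ.≢-nonZero λ ∣↥q∣≡0 → q≢0 (ℚP.↥p≡0⇒p≡0 q (ℤP.∣i∣≡0⇒i≡0 ∣↥q∣≡0))

coprime-*ˡ : ∀ {a b c} → Coprime a c → Coprime b c → Coprime (a ℕ.* b) c
coprime-*ˡ {a} {b} {c} a⊥c b⊥c {d} (d∣ab , d∣c) = b⊥c (coprime-divisor d⊥a d∣ab , d∣c)
  where
  d⊥a : Coprime d a
  d⊥a (e∣d , e∣a) = a⊥c (e∣a , ∣-trans e∣d d∣c)

coprime-squares : ∀ {a b} → Coprime a b → Coprime (a ℕ.* a) (b ℕ.* b)
coprime-squares a⊥b = Coprimality.sym (coprime-*ˡ b⊥a² b⊥a²)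
  where
  b⊥a² = Coprimality.sym (coprime-*ˡ a⊥b a⊥b)

coprime-difference : ∀ x y → Coprime ℤ.∣ x ∣ ℤ.∣ y ∣ →
                     Coprime ℤ.∣ x ℤ.- y ∣ ℤ.∣ x ∣ × Coprime ℤ.∣ x ℤ.- y ∣ ℤ.∣ y ∣
coprime-difference x y x⊥y = ⊥x , ⊥y
  where
  x-[x-y]≡y : ∀ x y → x ℤ.- (x ℤ.- y) ≡ y
  x-[x-y]≡y = ℤ-Solver.solve-∀
  [x-y]+y≡x : ∀ x y → (x ℤ.- y) ℤ.+ y ≡ x
  [x-y]+y≡x = ℤ-Solver.solve-∀
  ⊥x : Coprime ℤ.∣ x ℤ.- y ∣ ℤ.∣ x ∣
  ⊥x (d∣x-y , d∣x) = x⊥y (d∣x , ∣⇒∣ᵤ (subst (+ _ ∣_) (x-[x-y]≡y x y)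
    (∣m∣n⇒∣m-n (∣ᵤ⇒∣ {i = x} d∣x) (∣ᵤ⇒∣ {i = x ℤ.- y} d∣x-y))))
  ⊥y : Coprime ℤ.∣ x ℤ.- y ∣ ℤ.∣ y ∣
  ⊥y (d∣x-y , d∣y) = x⊥y (∣⇒∣ᵤ (subst (+ _ ∣_) ([x-y]+y≡x x y)
    (∣m∣n⇒∣m+n (∣ᵤ⇒∣ {i = x ℤ.- y} d∣x-y) (∣ᵤ⇒∣ {i = y} d∣y))) , d∣y)

coprime-cross : ∀ {a b c d} → a ℕ.* c ≡ b ℕ.* d → Coprime a b → Coprime c d → a ≡ d × b ≡ c
coprime-cross {a} {b} {c} {d} ac≡bd a⊥b c⊥d = ∣-antisym a∣d d∣a , ∣-antisym b∣c c∣b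
  where
  a∣d = coprime-divisor a⊥b (divides c (trans (sym ac≡bd) (ℕP.*-comm a c)))
  d∣a = coprime-divisor (Coprimality.sym c⊥d) (divides b (trans (ℕP.*-comm c a) ac≡bd))
  b∣c = coprime-divisor (Coprimality.sym a⊥b) (divides d (trans ac≡bd (ℕP.*-comm b d)))
  c∣b = coprime-divisor c⊥d (divides a (trans (ℕP.*-comm d b) (sym ac≡bd)))

lowest-terms : ∀ p m n → Coprime ℤ.∣ m ∣ ℤ.∣ n ∣ → p * fromℤ n ≡ fromℤ m →
               ℤ.∣ ↥ p ∣ ≡ ℤ.∣ m ∣ × ↧ₙ p ≡ ℤ.∣ n ∣
lowest-terms p m n m⊥n p*n≡m = coprime-cross cross (numerator-coprime p) (Coprimality.sym m⊥n)
  where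
  cross-ℤ : ↥ p ℤ.* n ≡ ↧ p ℤ.* m
  cross-ℤ = fromℤ-injective (begin
    fromℤ (↥ p ℤ.* n)           ≡⟨ fromℤ-* (↥ p) n ⟩
    fromℤ (↥ p) * fromℤ n       ≡⟨ cong (_* fromℤ n) (sym (p*↧p≡↥p p)) ⟩
    p * fromℤ (↧ p) * fromℤ n   ≡⟨ swap p (fromℤ (↧ p)) (fromℤ n) ⟩
    fromℤ (↧ p) * (p * fromℤ n) ≡⟨ cong (fromℤ (↧ p) *_) p*n≡m ⟩
    fromℤ (↧ p) * fromℤ m       ≡⟨ sym (fromℤ-* (↧ p) m) ⟩
    fromℤ (↧ p ℤ.* m)           ∎)
    where
    swap : ∀ a b c → a * b * c ≡ b * (a * c)
    swap = solve-∀ ℚ-ring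
  cross : ℤ.∣ ↥ p ∣ ℕ.* ℤ.∣ n ∣ ≡ ↧ₙ p ℕ.* ℤ.∣ m ∣
  cross = begin
    ℤ.∣ ↥ p ∣ ℕ.* ℤ.∣ n ∣ ≡⟨ sym (ℤP.abs-* (↥ p) n) ⟩
    ℤ.∣ ↥ p ℤ.* n ∣       ≡⟨ cong ℤ.∣_∣ cross-ℤ ⟩
    ℤ.∣ ↧ p ℤ.* m ∣       ≡⟨ ℤP.abs-* (↧ p) m ⟩
    ↧ₙ p ℕ.* ℤ.∣ m ∣      ∎

IsSquare : ℚ → Set
IsSquare c = ∃ λ t → t * t ≡ c

square-lowest-terms : ∀ s q → s * s ≡ q →
  ℤ.∣ ↥ q ∣ ≡ ℤ.∣ ↥ s ∣ ℕ.* ℤ.∣ ↥ s ∣ × ↧ₙ q ≡ ↧ₙ s ℕ.* ↧ₙ s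
square-lowest-terms s q s²≡q =
  trans (proj₁ terms) (ℤP.abs-* (↥ s) (↥ s)) , trans (proj₂ terms) (ℤP.abs-* (↧ s) (↧ s))
  where
  coprime : Coprime ℤ.∣ ↥ s ℤ.* ↥ s ∣ ℤ.∣ ↧ s ℤ.* ↧ s ∣
  coprime rewrite ℤP.abs-* (↥ s) (↥ s) | ℤP.abs-* (↧ s) (↧ s) =
    coprime-squares (numerator-coprime s)
  rearrange : ∀ a b → (a * a) * (b * b) ≡ (a * b) * (a * b)
  rearrange = solve-∀ ℚ-ring
  cleared : q * fromℤ (↧ s ℤ.* ↧ s) ≡ fromℤ (↥ s ℤ.* ↥ s)
  cleared = begin
    q * fromℤ (↧ s ℤ.* ↧ s)                   ≡⟨ cong₂ _*_ (sym s²≡q) (fromℤ-* (↧ s) (↧ s)) ⟩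
    (s * s) * (fromℤ (↧ s) * fromℤ (↧ s))     ≡⟨ rearrange s (fromℤ (↧ s)) ⟩
    (s * fromℤ (↧ s)) * (s * fromℤ (↧ s))     ≡⟨ cong (λ r → r * r) (p*↧p≡↥p s) ⟩
    fromℤ (↥ s) * fromℤ (↥ s)                 ≡⟨ sym (fromℤ-* (↥ s) (↥ s)) ⟩
    fromℤ (↥ s ℤ.* ↥ s)                       ∎
  terms = lowest-terms q (↥ s ℤ.* ↥ s) (↧ s ℤ.* ↧ s) coprime cleared

2-not-square : ∀ s → s * s ≢ 2ℚ
2-not-square s s²≡2 = m*m≢2 ℤ.∣ ↥ s ∣ (sym (proj₁ (square-lowest-terms s 2ℚ s²≡2)))
  where
  m*m≢2 : ∀ m → m ℕ.* m ≢ 2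
  m*m≢2 0 ()
  m*m≢2 1 ()
  m*m≢2 (suc (suc m)) eq = ℕP.0≢1+n (sym (ℕP.m+n≡0⇒n≡0 m (ℕP.suc-injective (ℕP.suc-injective eq))))

m≤m*m : ∀ m → m ℕ.≤ m ℕ.* m
m≤m*m zero        = z≤n
m≤m*m m@(suc _)   = ℕP.m≤m*n m m

∣p∣*∣p∣≡p*p : ∀ p → ℚ.∣ p ∣ * ℚ.∣ p ∣ ≡ p * p
∣p∣*∣p∣≡p*p p with ℚP.∣p∣≡p∨∣p∣≡-p p
... | inj₁ ∣p∣≡p  = cong (λ r → r * r) ∣p∣≡p
... | inj₂ ∣p∣≡-p = trans (cong (λ r → r * r) ∣p∣≡-p) (neg-square p)
  where
  neg-square : ∀ p → - p * - p ≡ p * p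
  neg-square = solve-∀ ℚ-ring

-- A root t of q has ∣↥ t∣ ≤ ∣↥ q∣ and ↧ t ≤ ↧ q by square-lowest-terms, so the bounded
-- search over the candidates m / (k + 1) is complete.
square? : ∀ q → Dec (IsSquare q)
square? q = map′ found complete
  (ℕP.anyUpTo? (λ m → ℕP.anyUpTo? (λ k → root? m k) (↧ₙ q)) (suc ℤ.∣ ↥ q ∣))
  where
  candidate : ℕ → ℕ → ℚ
  candidate m k = + m ℚ./ suc k
  IsRoot : ℕ → ℕ → Set
  IsRoot m k = candidate m k * candidate m k ≡ q
  root? : ∀ m k → Dec (IsRoot m k)
  root? m k = candidate m k * candidate m k ≟ q
  found : (∃ λ m → m ℕ.< suc ℤ.∣ ↥ q ∣ × ∃ λ k → k ℕ.< ↧ₙ q × IsRoot m k) → IsSquare q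
  found (m , _ , k , _ , root) = candidate m k , root
  complete : IsSquare q → ∃ λ m → m ℕ.< suc ℤ.∣ ↥ q ∣ × ∃ λ k → k ℕ.< ↧ₙ q × IsRoot m k
  complete (s@record{} , s²≡q) =
    ℤ.∣ ↥ s ∣ , s≤s numerator-bound , ℚ.denominator-1 s , denominator-bound , root
    where
    terms = square-lowest-terms s q s²≡q
    numerator-bound : ℤ.∣ ↥ s ∣ ℕ.≤ ℤ.∣ ↥ q ∣
    numerator-bound = subst (ℤ.∣ ↥ s ∣ ℕ.≤_) (sym (proj₁ terms)) (m≤m*m ℤ.∣ ↥ s ∣)
    denominator-bound : ↧ₙ s ℕ.≤ ↧ₙ q
    denominator-bound = subst (↧ₙ s ℕ.≤_) (sym (proj₂ terms)) (ℕP.m≤m*n (↧ₙ s) (↧ₙ s))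
    root : IsRoot ℤ.∣ ↥ s ∣ (ℚ.denominator-1 s)
    root = begin
      candidate ℤ.∣ ↥ s ∣ (ℚ.denominator-1 s) * candidate ℤ.∣ ↥ s ∣ (ℚ.denominator-1 s)
        ≡⟨ cong (λ r → r * r) (ℚP.↥p/↧p≡p ℚ.∣ s ∣) ⟩
      ℚ.∣ s ∣ * ℚ.∣ s ∣  ≡⟨ ∣p∣*∣p∣≡p*p s ⟩
      s * s              ≡⟨ s²≡q ⟩
      q                  ∎

square-*-square : ∀ {c} k → IsSquare c → IsSquare (c * (k * k))
square-*-square {c} k (t , t²≡c) = t * k , (begin
  (t * k) * (t * k)  ≡⟨ rearrange t k ⟩
  (t * t) * (k * k)  ≡⟨ cong (_* (k * k)) t²≡c ⟩
  c * (k * k)        ∎)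
  where
  rearrange : ∀ a b → (a * b) * (a * b) ≡ (a * a) * (b * b)
  rearrange = solve-∀ ℚ-ring

square-cancelˡ : ∀ {q r} → q ≢ 0ℚ → IsSquare q → IsSquare (q * r) → IsSquare r
square-cancelˡ {q} {r} q≢0 (s , s²≡q) (t , t²≡qr) = t * 1/ s , (begin
  (t * 1/ s) * (t * 1/ s)           ≡⟨ rearrange t (1/ s) ⟩
  (t * t) * (1/ s * 1/ s)
    ≡⟨ cong (λ x → x * (1/ s * 1/ s)) (trans t²≡qr (cong (_* r) (sym s²≡q))) ⟩
  ((s * s) * r) * (1/ s * 1/ s)     ≡⟨ regroup s (1/ s) r ⟩
  ((s * 1/ s) * (s * 1/ s)) * r     ≡⟨ cong (λ x → (x * x) * r) (ℚP.*-inverseʳ s) ⟩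
  (1ℚ * 1ℚ) * r                     ≡⟨ ℚP.*-identityˡ r ⟩
  r                                 ∎)
  where
  s≢0 : s ≢ 0ℚ
  s≢0 s≡0 = q≢0 (trans (sym s²≡q) (cong (λ x → x * x) s≡0))
  instance _ = ≢-nonZero s≢0
  rearrange : ∀ a b → (a * b) * (a * b) ≡ (a * a) * (b * b)
  rearrange = solve-∀ ℚ-ring
  regroup : ∀ a b c → ((a * a) * c) * (b * b) ≡ ((a * b) * (a * b)) * c
  regroup = solve-∀ ℚ-ring

roots : ∀ {c} → Dec (IsSquare c) → List ℚ
roots (yes (t , _)) = t ∷ - t ∷ []
roots (no _)        = []

∈-roots : ∀ {c} (d : Dec (IsSquare c)) z → z ∈ roots d ⇔ z * z ≡ c
∈-roots (yes (t , t²≡c)) z = mk⇔ root⇒square square⇒root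
  where
  neg-square : ∀ p → - p * - p ≡ p * p
  neg-square = solve-∀ ℚ-ring
  root⇒square : z ∈ t ∷ - t ∷ [] → z * z ≡ _
  root⇒square (here refl)         = t²≡c
  root⇒square (there (here refl)) = trans (neg-square t) t²≡c
  square⇒root : z * z ≡ _ → z ∈ t ∷ - t ∷ []
  square⇒root z²≡c = [ here , there ∘ here ]′ (p*p≡q*q⇒p≡q⊎p≡-q z t (trans z²≡c (sym t²≡c)))
∈-roots (no ¬square) z = mk⇔ (λ ()) (λ z²≡c → ⊥-elim (¬square (z , z²≡c)))

roots-unique : ∀ {c} → c ≢ 0ℚ → (d : Dec (IsSquare c)) → Unique (roots d)
roots-unique c≢0 (yes (t , t²≡c)) = (t≢-t ∷ []) ∷ [] ∷ []
  where
  t≢-t : t ≢ - t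
  t≢-t t≡-t = c≢0 (trans (sym t²≡c) (cong (λ x → x * x) (p≡-p⇒p≡0 t≡-t)))
roots-unique c≢0 (no _) = []

∈-++⇔ : ∀ {A : Set} (xs : List A) {ys v} → v ∈ xs ++ ys ⇔ (v ∈ xs ⊎ v ∈ ys)
∈-++⇔ xs = mk⇔ (∈-++⁻ xs) [ ∈-++⁺ˡ , ∈-++⁺ʳ xs ]′

roots-disjoint : ∀ {c c′} (d : Dec (IsSquare c)) (d′ : Dec (IsSquare c′)) → c ≢ c′ →
                 Disjoint (roots d) (roots d′)
roots-disjoint d d′ c≢c′ {z} (z∈ , z∈′) =
  c≢c′ (trans (sym (to (∈-roots d z) z∈)) (to (∈-roots d′ z) z∈′))

iter-+ : ∀ {A : Set} (f : A → A) m n x → iter f (m ℕ.+ n) x ≡ iter f m (iter f n x)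
iter-+ f zero    n x = refl
iter-+ f (suc m) n x = cong f (iter-+ f m n x)

iter-preserves : ∀ {A : Set} {f : A → A} (Q : A → Set) → (∀ {x} → Q x → Q (f x)) →
                 ∀ n {x} → Q x → Q (iter f n x)
iter-preserves Q f-preserves zero    Qx = Qx
iter-preserves Q f-preserves (suc n) Qx = f-preserves (iter-preserves Q f-preserves n Qx)

preperiodic⇒periodic-iterate : ∀ {A : Set} {f : A → A} {x} → Preperiodic f x →
                               ∃₂ λ m k → iter f (suc k) (iter f m x) ≡ iter f m x
preperiodic⇒periodic-iterate {f = f} {x} (n , m , m<n , fⁿx≡fᵐx) = m , n ℕ.∸ suc m , (begin
  iter f (suc k) (iter f m x)  ≡⟨ sym (iter-+ f (suc k) m x) ⟩
  iter f (suc k ℕ.+ m) x       ≡⟨ cong (λ i → iter f i x) k+m≡n ⟩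
  iter f n x                   ≡⟨ fⁿx≡fᵐx ⟩
  iter f m x                   ∎)
  where
  k = n ℕ.∸ suc m
  k+m≡n : suc k ℕ.+ m ≡ n
  k+m≡n = trans (sym (ℕP.+-suc k m)) (ℕP.m∸n+n≡m m<n)

iter-semiconj : ∀ {A B : Set} {f : A → A} {g : B → B} (h : A → B) →
                (∀ x → h (f x) ≡ g (h x)) → ∀ n x → h (iter f n x) ≡ iter g n (h x)
iter-semiconj h h∘f≡g∘h zero    x = refl
iter-semiconj {g = g} h h∘f≡g∘h (suc n) x =
  trans (h∘f≡g∘h _) (cong g (iter-semiconj h h∘f≡g∘h n x))

preperiodic-semiconj : ∀ {A B : Set} {f : A → A} {g : B → B} (h : A → B) →
                       (∀ x → h (f x) ≡ g (h x)) → ∀ {x} → Preperiodic f x → Preperiodic g (h x)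
preperiodic-semiconj {f = f} {g} h h∘f≡g∘h {x} (n , m , m<n , fⁿx≡fᵐx) =
  n , m , m<n , (begin
  iter g n (h x)  ≡⟨ sym (iter-semiconj h h∘f≡g∘h n x) ⟩
  h (iter f n x)  ≡⟨ cong h fⁿx≡fᵐx ⟩
  h (iter f m x)  ≡⟨ iter-semiconj h h∘f≡g∘h m x ⟩
  iter g m (h x)  ∎)

ψℚ : (u : ℚ) → u ≢ 0ℚ → ℚ
ψℚ u u≢0 = u + 1/_ u {{≢-nonZero u≢0}} - 2ℚ

ψ : ℙ¹ℚ → ℙ¹ℚ
ψ nothing = nothing
ψ (just u) with u ≟ 0ℚ
... | yes _   = nothing
... | no u≢0  = just (ψℚ u u≢0)

ψ-just : ∀ u (u≢0 : u ≢ 0ℚ) → ψ (just u) ≡ just (ψℚ u u≢0)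
ψ-just u u≢0 with u ≟ 0ℚ
... | yes u≡0 = ⊥-elim (u≢0 u≡0)
... | no _    = refl

ψℚ-cong : ∀ {p q} (p≢0 : p ≢ 0ℚ) (q≢0 : q ≢ 0ℚ) → p ≡ q → ψℚ p p≢0 ≡ ψℚ q q≢0
ψℚ-cong _ _ refl = refl

ψℚ-lowest-terms : ∀ q (q≢0 : q ≢ 0ℚ) →
  ℤ.∣ ↥ ψℚ q q≢0 ∣ ≡ ℤ.∣ ↥ q ℤ.- ↧ q ∣ ℕ.* ℤ.∣ ↥ q ℤ.- ↧ q ∣ × ↧ₙ ψℚ q q≢0 ≡ ℤ.∣ ↥ q ∣ ℕ.* ↧ₙ q
ψℚ-lowest-terms q q≢0 =
  trans (proj₁ terms) (ℤP.abs-* (x ℤ.- y) (x ℤ.- y)) , trans (proj₂ terms) (ℤP.abs-* x y)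
  where
  instance _ = ≢-nonZero q≢0
  x = ↥ q
  y = ↧ q
  Y = fromℤ y
  coprime : Coprime ℤ.∣ (x ℤ.- y) ℤ.* (x ℤ.- y) ∣ ℤ.∣ x ℤ.* y ∣
  coprime rewrite ℤP.abs-* (x ℤ.- y) (x ℤ.- y) | ℤP.abs-* x y =
    coprime-*ˡ ⊥xy ⊥xy
    where
    ⊥x,⊥y = coprime-difference x y (numerator-coprime q)
    ⊥xy = Coprimality.sym (coprime-*ˡ (Coprimality.sym (proj₁ ⊥x,⊥y)) (Coprimality.sym (proj₂ ⊥x,⊥y)))
  expand : ∀ q w Y →
           (q + w - 2ℚ) * ((q * Y) * Y) ≡ (q * Y - Y) * (q * Y - Y) + (q * w - 1ℚ) * (Y * Y)
  expand = solve-∀ ℚ-ring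
  cancel : ∀ A B → A + (1ℚ - 1ℚ) * B ≡ A
  cancel = solve-∀ ℚ-ring
  cleared : ψℚ q q≢0 * fromℤ (x ℤ.* y) ≡ fromℤ ((x ℤ.- y) ℤ.* (x ℤ.- y))
  cleared = begin
    ψℚ q q≢0 * fromℤ (x ℤ.* y)                            ≡⟨ cong (ψℚ q q≢0 *_) (fromℤ-* x y) ⟩
    ψℚ q q≢0 * (fromℤ x * Y)
      ≡⟨ cong (λ X → ψℚ q q≢0 * (X * Y)) (sym (p*↧p≡↥p q)) ⟩
    (q + 1/ q - 2ℚ) * ((q * Y) * Y)                       ≡⟨ expand q (1/ q) Y ⟩
    (q * Y - Y) * (q * Y - Y) + (q * 1/ q - 1ℚ) * (Y * Y)
      ≡⟨ cong (λ r → (q * Y - Y) * (q * Y - Y) + (r - 1ℚ) * (Y * Y)) (ℚP.*-inverseʳ q) ⟩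
    (q * Y - Y) * (q * Y - Y) + (1ℚ - 1ℚ) * (Y * Y)       ≡⟨ cancel ((q * Y - Y) * (q * Y - Y)) (Y * Y) ⟩
    (q * Y - Y) * (q * Y - Y)                             ≡⟨ cong (λ X → (X - Y) * (X - Y)) (p*↧p≡↥p q) ⟩
    (fromℤ x - Y) * (fromℤ x - Y)                         ≡⟨ cong (λ r → r * r) (sym (fromℤ-- x y)) ⟩
    fromℤ (x ℤ.- y) * fromℤ (x ℤ.- y)                     ≡⟨ sym (fromℤ-* (x ℤ.- y) (x ℤ.- y)) ⟩
    fromℤ ((x ℤ.- y) ℤ.* (x ℤ.- y))                       ∎
  terms = lowest-terms (ψℚ q q≢0) ((x ℤ.- y) ℤ.* (x ℤ.- y)) (x ℤ.* y) coprime cleared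

Exceptional : ℙ¹ℚ → Set
Exceptional nothing  = ⊤
Exceptional (just u) = u ≡ 0ℚ ⊎ u ≡ 1ℚ ⊎ u ≡ ½ ⊎ u ≡ 2ℚ

exceptional? : ∀ P → Dec (Exceptional P)
exceptional? nothing  = yes tt
exceptional? (just u) = (u ≟ 0ℚ) ⊎-dec (u ≟ 1ℚ) ⊎-dec (u ≟ ½) ⊎-dec (u ≟ 2ℚ)

exceptional-denominator≤2 : ∀ {v} → Exceptional (just v) → ↧ₙ v ℕ.≤ 2
exceptional-denominator≤2 (inj₁ refl)               = s≤s z≤n
exceptional-denominator≤2 (inj₂ (inj₁ refl))        = s≤s z≤n
exceptional-denominator≤2 (inj₂ (inj₂ (inj₁ refl))) = s≤s (s≤s z≤n)
exceptional-denominator≤2 (inj₂ (inj₂ (inj₂ refl))) = s≤s z≤n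

small-height : ∀ q → q ≢ 0ℚ → ℤ.∣ ↥ q ∣ ℕ.* ↧ₙ q ℕ.≤ 2 →
  q ≡ 1ℚ ⊎ q ≡ ½ ⊎ q ≡ 2ℚ ⊎ q ≡ - 1ℚ ⊎ q ≡ - ½ ⊎ q ≡ - 2ℚ
small-height q@(mkℚ x d _) q≢0 height≤2 =
  enumerate x d (λ x≡0 → q≢0 (ℚP.↥p≡0⇒p≡0 q x≡0)) numerator≤2 denominator≤2 height≤2
  where
  instance _ = numerator-nonZero q≢0
  numerator≤2 : ℤ.∣ x ∣ ℕ.≤ 2
  numerator≤2 = ℕP.≤-trans (ℕP.m≤m*n ℤ.∣ x ∣ (suc d)) height≤2
  denominator≤2 : suc d ℕ.≤ 2
  denominator≤2 = ℕP.≤-trans (ℕP.m≤n*m (suc d) ℤ.∣ x ∣) height≤2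
  enumerate : ∀ x d .{c : Coprime ℤ.∣ x ∣ (suc d)} → x ≢ + 0 →
              ℤ.∣ x ∣ ℕ.≤ 2 → suc d ℕ.≤ 2 → ℤ.∣ x ∣ ℕ.* suc d ℕ.≤ 2 → let r = mkℚ x d c in
              r ≡ 1ℚ ⊎ r ≡ ½ ⊎ r ≡ 2ℚ ⊎ r ≡ - 1ℚ ⊎ r ≡ - ½ ⊎ r ≡ - 2ℚ
  enumerate (+ 1)    0 _ _ _ _ = inj₁ refl
  enumerate (+ 1)    1 _ _ _ _ = inj₂ (inj₁ refl)
  enumerate (+ 2)    0 _ _ _ _ = inj₂ (inj₂ (inj₁ refl))
  enumerate -[1+ 0 ] 0 _ _ _ _ = inj₂ (inj₂ (inj₂ (inj₁ refl)))
  enumerate -[1+ 0 ] 1 _ _ _ _ = inj₂ (inj₂ (inj₂ (inj₂ (inj₁ refl))))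
  enumerate -[1+ 1 ] 0 _ _ _ _ = inj₂ (inj₂ (inj₂ (inj₂ (inj₂ refl))))
  enumerate (+ 0)    _ x≢0 _ _ _ = ⊥-elim (x≢0 refl)
  enumerate (+ 2)    1 _ _ _ (s≤s (s≤s ()))
  enumerate -[1+ 1 ] 1 _ _ _ (s≤s (s≤s ()))
  enumerate (+ suc (suc (suc _))) _ _ (s≤s (s≤s ())) _ _
  enumerate -[1+ suc (suc _) ]    _ _ (s≤s (s≤s ())) _ _
  enumerate _ (suc (suc _)) _ _ (s≤s (s≤s ())) _

exceptional-preimage : ∀ q (q≢0 : q ≢ 0ℚ) → Exceptional (just (ψℚ q q≢0)) → Exceptional (just q)
exceptional-preimage q q≢0 exc = classify (small-height q q≢0 height≤2)
  where
  height≤2 : ℤ.∣ ↥ q ∣ ℕ.* ↧ₙ q ℕ.≤ 2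
  height≤2 = subst (ℕ._≤ 2) (proj₂ (ψℚ-lowest-terms q q≢0)) (exceptional-denominator≤2 exc)
  -- ψ(-1) = -4 and ψ(-1/2) = ψ(-2) = -9/2 are not exceptional: decided by evaluation.
  not-preimage : ∀ r (r≢0 : r ≢ 0ℚ) → q ≡ r → False (exceptional? (just (ψℚ r r≢0))) →
                 Exceptional (just q)
  not-preimage r r≢0 q≡r ¬exc = ⊥-elim (toWitnessFalse {a? = exceptional? (just (ψℚ r r≢0))} ¬exc
    (subst (Exceptional ∘ just) (ψℚ-cong q≢0 r≢0 q≡r) exc))
  classify : q ≡ 1ℚ ⊎ q ≡ ½ ⊎ q ≡ 2ℚ ⊎ q ≡ - 1ℚ ⊎ q ≡ - ½ ⊎ q ≡ - 2ℚ → Exceptional (just q)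
  classify (inj₁ q≡1)                              = inj₂ (inj₁ q≡1)
  classify (inj₂ (inj₁ q≡½))                       = inj₂ (inj₂ (inj₁ q≡½))
  classify (inj₂ (inj₂ (inj₁ q≡2)))                = inj₂ (inj₂ (inj₂ q≡2))
  classify (inj₂ (inj₂ (inj₂ (inj₁ q≡-1))))        = not-preimage (- 1ℚ) (λ ()) q≡-1 _
  classify (inj₂ (inj₂ (inj₂ (inj₂ (inj₁ q≡-½))))) = not-preimage (- ½) (λ ()) q≡-½ _
  classify (inj₂ (inj₂ (inj₂ (inj₂ (inj₂ q≡-2))))) = not-preimage (- 2ℚ) (λ ()) q≡-2 _

ψℚ-denominator-≤ : ∀ q (q≢0 : q ≢ 0ℚ) → ↧ₙ q ℕ.≤ ↧ₙ ψℚ q q≢0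
ψℚ-denominator-≤ q q≢0 =
  subst (↧ₙ q ℕ.≤_) (sym (proj₂ (ψℚ-lowest-terms q q≢0))) (ℕP.m≤n*m (↧ₙ q) ℤ.∣ ↥ q ∣)
  where instance _ = numerator-nonZero q≢0

unit-neighbours : ∀ x d → ℤ.∣ x ∣ ≡ 1 → ℤ.∣ x ℤ.- + suc d ∣ ≡ 1 → x ≡ + 1 × d ≡ 1
unit-neighbours (+ 1)           1             _  _  = refl , refl
unit-neighbours (+ 1)           0             _  ()
unit-neighbours (+ 1)           (suc (suc _)) _  ()
unit-neighbours -[1+ 0 ]        _             _  ()
unit-neighbours (+ 0)           _             ()
unit-neighbours (+ suc (suc _)) _             ()
unit-neighbours -[1+ suc _ ]    _             ()

-- With v = ψ q and q = x / y: ↧ (ψ v) = ∣↥ v∣ ∣x∣ y and ∣↥ v∣ = (x - y)², so the factor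
-- ∣↥ v∣ ∣x∣ is 1 only for x = 1, y = 2.
ψℚ²-denominator-> : ∀ q (q≢0 : q ≢ 0ℚ) (v≢0 : ψℚ q q≢0 ≢ 0ℚ) → q ≢ ½ →
                    ↧ₙ q ℕ.< ↧ₙ ψℚ (ψℚ q q≢0) v≢0
ψℚ²-denominator-> q@(mkℚ x d _) q≢0 v≢0 q≢½ = grows (a ℕ.* n) refl
  where
  v = ψℚ q q≢0
  a = ℤ.∣ ↥ v ∣
  n = ℤ.∣ x ∣
  v-terms = ψℚ-lowest-terms q q≢0
  ↧ψv≡an*↧q : ↧ₙ ψℚ v v≢0 ≡ (a ℕ.* n) ℕ.* suc d
  ↧ψv≡an*↧q = begin
    ↧ₙ ψℚ v v≢0            ≡⟨ proj₂ (ψℚ-lowest-terms v v≢0) ⟩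
    a ℕ.* ↧ₙ v             ≡⟨ cong (a ℕ.*_) (proj₂ v-terms) ⟩
    a ℕ.* (n ℕ.* suc d)    ≡⟨ sym (ℕP.*-assoc a n (suc d)) ⟩
    (a ℕ.* n) ℕ.* suc d    ∎
  grows : ∀ g → a ℕ.* n ≡ g → suc d ℕ.< ↧ₙ ψℚ v v≢0
  grows 0 an≡0 with ℕP.m*n≡0⇒m≡0∨n≡0 a an≡0
  ... | inj₁ a≡0 = ⊥-elim (v≢0 (ℚP.↥p≡0⇒p≡0 v (ℤP.∣i∣≡0⇒i≡0 a≡0)))
  ... | inj₂ n≡0 = ⊥-elim (q≢0 (ℚP.↥p≡0⇒p≡0 q (ℤP.∣i∣≡0⇒i≡0 n≡0)))
  grows 1 an≡1 = ⊥-elim (q≢½ (ℚP.mkℚ-cong x≡1 d≡1))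
    where
    ∣x-y∣≡1 : ℤ.∣ x ℤ.- + suc d ∣ ≡ 1
    ∣x-y∣≡1 = ℕP.m*n≡1⇒m≡1 _ _ (trans (sym (proj₁ v-terms)) (ℕP.m*n≡1⇒m≡1 a n an≡1))
    x≡1 = proj₁ (unit-neighbours x d (ℕP.m*n≡1⇒n≡1 a n an≡1) ∣x-y∣≡1)
    d≡1 = proj₂ (unit-neighbours x d (ℕP.m*n≡1⇒n≡1 a n an≡1) ∣x-y∣≡1)
  grows (suc (suc k)) an≡2+k = subst (suc d ℕ.<_) (begin
    suc d ℕ.* suc (suc k)     ≡⟨ ℕP.*-comm (suc d) (suc (suc k)) ⟩
    suc (suc k) ℕ.* suc d     ≡⟨ cong (ℕ._* suc d) (sym an≡2+k) ⟩
    (a ℕ.* n) ℕ.* suc d       ≡⟨ sym ↧ψv≡an*↧q ⟩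
    ↧ₙ ψℚ v v≢0               ∎) (ℕP.m<m*n (suc d) (suc (suc k)) (s≤s (s≤s z≤n)))

-- The value at ∞ is junk: only non-exceptional, hence affine, points are ever measured.
denominator : ℙ¹ℚ → ℕ
denominator nothing  = 0
denominator (just q) = ↧ₙ q

non-exceptional⇒≢0 : ∀ {q} → ¬ Exceptional (just q) → q ≢ 0ℚ
non-exceptional⇒≢0 ¬exc = ¬exc ∘ inj₁

ψ-preserves-non-exceptional : ∀ {P} → ¬ Exceptional P → ¬ Exceptional (ψ P)
ψ-preserves-non-exceptional {nothing} ¬exc = ⊥-elim (¬exc tt)
ψ-preserves-non-exceptional {just q}  ¬exc =
  subst (¬_ ∘ Exceptional) (sym (ψ-just q q≢0)) (¬exc ∘ exceptional-preimage q q≢0)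
  where q≢0 = non-exceptional⇒≢0 ¬exc

ψ-denominator-≤ : ∀ {P} → ¬ Exceptional P → denominator P ℕ.≤ denominator (ψ P)
ψ-denominator-≤ {nothing} ¬exc = ⊥-elim (¬exc tt)
ψ-denominator-≤ {just q}  ¬exc =
  subst (λ R → ↧ₙ q ℕ.≤ denominator R) (sym (ψ-just q q≢0)) (ψℚ-denominator-≤ q q≢0)
  where q≢0 = non-exceptional⇒≢0 ¬exc

ψ²-denominator-< : ∀ {P} → ¬ Exceptional P → denominator P ℕ.< denominator (ψ (ψ P))
ψ²-denominator-< {nothing} ¬exc = ⊥-elim (¬exc tt)
ψ²-denominator-< {just q}  ¬exc = subst (λ R → ↧ₙ q ℕ.< denominator R) (sym ψψq≡)
  (ψℚ²-denominator-> q q≢0 v≢0 (¬exc ∘ inj₂ ∘ inj₂ ∘ inj₁))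
  where
  q≢0 = non-exceptional⇒≢0 ¬exc
  v = ψℚ q q≢0
  v≢0 : v ≢ 0ℚ
  v≢0 = non-exceptional⇒≢0
    (subst (¬_ ∘ Exceptional) (ψ-just q q≢0) (ψ-preserves-non-exceptional ¬exc))
  ψψq≡ : ψ (ψ (just q)) ≡ just (ψℚ v v≢0)
  ψψq≡ = trans (cong ψ (ψ-just q q≢0)) (ψ-just v v≢0)

iter-ψ-denominator-< : ∀ {P} → ¬ Exceptional P → ∀ k →
                       denominator P ℕ.< denominator (iter ψ (2 ℕ.+ k) P)
iter-ψ-denominator-< ¬exc zero    = ψ²-denominator-< ¬exc
iter-ψ-denominator-< ¬exc (suc k) = ℕP.<-≤-trans (iter-ψ-denominator-< ¬exc k)
  (ψ-denominator-≤ (iter-preserves (¬_ ∘ Exceptional) ψ-preserves-non-exceptional (2 ℕ.+ k) ¬exc))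

non-exceptional-aperiodic : ∀ {P} → ¬ Exceptional P → ∀ k → iter ψ (suc k) P ≢ P
non-exceptional-aperiodic ¬exc zero    ψP≡P =
  ℕP.<-irrefl (cong denominator (sym (trans (cong ψ ψP≡P) ψP≡P))) (ψ²-denominator-< ¬exc)
non-exceptional-aperiodic ¬exc (suc k) ψᵏP≡P =
  ℕP.<-irrefl (cong denominator (sym ψᵏP≡P)) (iter-ψ-denominator-< ¬exc k)

ψ-preperiodic⇒exceptional : ∀ {P} → Preperiodic ψ P → Exceptional P
ψ-preperiodic⇒exceptional {P} preperiodic = decidable-stable (exceptional? P) λ ¬exc →
  let m , k , periodic = preperiodic⇒periodic-iterate preperiodic in
  non-exceptional-aperiodic
    (iter-preserves (¬_ ∘ Exceptional) ψ-preserves-non-exceptional m ¬exc) k periodic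

φ-just-≡ : ∀ b {z w} → z ≢ 0ℚ → w * z ≡ z * z + b → φ b (just z) ≡ just w
φ-just-≡ b {z} {w} z≢0 wz≡z²+b with z ≟ 0ℚ
... | yes z≡0 = ⊥-elim (z≢0 z≡0)
... | no _    = cong just (*-cancelˡ-≢0 z z≢0 (begin
  z * (z + b * 1/ z)     ≡⟨ expand z b (1/ z) ⟩
  z * z + b * (z * 1/ z) ≡⟨ cong (λ r → z * z + b * r) (ℚP.*-inverseʳ z) ⟩
  z * z + b * 1ℚ         ≡⟨ cong (λ r → z * z + r) (ℚP.*-identityʳ b) ⟩
  z * z + b              ≡⟨ sym wz≡z²+b ⟩
  w * z                  ≡⟨ ℚP.*-comm w z ⟩
  z * w                  ∎))
  where
  instance _ = ≢-nonZero z≢0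
  expand : ∀ z b i → z * (z + b * i) ≡ z * z + b * (z * i)
  expand = solve-∀ ℚ-ring

module Dynamics (b : ℚ) (b≢0 : b ≢ 0ℚ) where

  -b≢0 : - b ≢ 0ℚ
  -b≢0 = b≢0 ∘ ℚP.neg-injective

  private instance
    -b-nonZero : NonZero (- b)
    -b-nonZero = ≢-nonZero -b≢0

  π : ℙ¹ℚ → ℙ¹ℚ
  π nothing  = nothing
  π (just z) = just (z * z * 1/ (- b))

  π-semiconj : ∀ P → π (φ b P) ≡ ψ (π P)
  π-semiconj nothing = refl
  π-semiconj (just z) with z ≟ 0ℚ
  ... | yes refl = cong (ψ ∘ just) (sym (ℚP.*-zeroˡ (1/ (- b))))
  ... | no z≢0 = trans (cong just (begin
    (z + b ÷ z) * (z + b ÷ z) * c                          ≡⟨ expand z w b c ⟩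
    u + w * w * - b * (c * - b) - 2ℚ * (z * w) * (c * - b)
      ≡⟨ cong₂ (λ r s → u + w * w * - b * r - 2ℚ * s * r) c*-b≡1 z*w≡1 ⟩
    u + w * w * - b * 1ℚ - 2ℚ * 1ℚ * 1ℚ                   ≡⟨ simplify u (w * w * - b) ⟩
    u + w * w * - b - 2ℚ                                   ≡⟨ cong (λ r → u + r - 2ℚ) (sym 1/u≡w²[-b]) ⟩
    ψℚ u u≢0                                               ∎)) (sym (ψ-just u u≢0))
    where
    instance _ = ≢-nonZero z≢0
    c = 1/ (- b)
    w = 1/ z
    u = z * z * c
    z*w≡1 : z * w ≡ 1ℚ
    z*w≡1 = ℚP.*-inverseʳ z
    c*-b≡1 : c * - b ≡ 1ℚ
    c*-b≡1 = ℚP.*-inverseˡ (- b)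
    c≢0 : c ≢ 0ℚ
    c≢0 c≡0 = ℚP.1≢0 (trans (sym c*-b≡1) (trans (cong (_* - b) c≡0) (ℚP.*-zeroˡ (- b))))
    u≢0 : u ≢ 0ℚ
    u≢0 = p*q≢0 (p*q≢0 z≢0 z≢0) c≢0
    regroup : ∀ z w c b → (z * z * c) * (w * w * b) ≡ (z * w) * (z * w) * (c * b)
    regroup = solve-∀ ℚ-ring
    1/u≡w²[-b] : 1/_ u {{≢-nonZero u≢0}} ≡ w * w * - b
    1/u≡w²[-b] = p*q≡1⇒1/p≡q u (w * w * - b) {{≢-nonZero u≢0}}
      (trans (regroup z w c (- b)) (cong₂ (λ r s → r * r * s) z*w≡1 c*-b≡1))
    expand : ∀ z w b c → (z + b * w) * (z + b * w) * c ≡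
             z * z * c + w * w * - b * (c * - b) - 2ℚ * (z * w) * (c * - b)
    expand = solve-∀ ℚ-ring
    simplify : ∀ A B → A + B * 1ℚ - 2ℚ * 1ℚ * 1ℚ ≡ A + B - 2ℚ
    simplify = solve-∀ ℚ-ring

  -- - b is written - b * 1ℚ so that the three cases differ only in the scale factor.
  SpecialSquare : ℚ → Set
  SpecialSquare r = r ≡ - b * 1ℚ ⊎ r ≡ - b * ½ ⊎ r ≡ - b * 2ℚ

  Special : ℙ¹ℚ → Set
  Special nothing  = ⊤
  Special (just z) = z ≡ 0ℚ ⊎ SpecialSquare (z * z)

  private
    scale-injective : ∀ {k k′} → - b * k ≡ - b * k′ → k ≡ k′
    scale-injective = *-cancelˡ-≢0 (- b) -b≢0

    special-square≢0 : ∀ {r} → SpecialSquare r → r ≢ 0ℚ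
    special-square≢0 (inj₁ refl)        = p*q≢0 -b≢0 (λ ())
    special-square≢0 (inj₂ (inj₁ refl)) = p*q≢0 -b≢0 (λ ())
    special-square≢0 (inj₂ (inj₂ refl)) = p*q≢0 -b≢0 (λ ())

    scaled-square : ∀ z {k} → z * z * 1/ (- b) ≡ k → z * z ≡ - b * k
    scaled-square z {k} z²c≡k = begin
      z * z                      ≡⟨ sym (ℚP.*-identityʳ (z * z)) ⟩
      z * z * 1ℚ                 ≡⟨ cong (z * z *_) (sym (ℚP.*-inverseˡ (- b))) ⟩
      z * z * (1/ (- b) * - b)   ≡⟨ regroup z (1/ (- b)) (- b) ⟩
      - b * (z * z * 1/ (- b))   ≡⟨ cong (- b *_) z²c≡k ⟩
      - b * k                    ∎
      where
      regroup : ∀ z c m → z * z * (c * m) ≡ m * (z * z * c)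
      regroup = solve-∀ ℚ-ring

  exceptional⇒special : ∀ P → Exceptional (π P) → Special P
  exceptional⇒special nothing  _ = tt
  exceptional⇒special (just z) (inj₁ z²c≡0) =
    inj₁ (reduce (p*q≡0⇒p≡0⊎q≡0 z z (trans (scaled-square z z²c≡0) (ℚP.*-zeroʳ (- b)))))
  exceptional⇒special (just z) (inj₂ (inj₁ z²c≡1))        = inj₂ (inj₁ (scaled-square z z²c≡1))
  exceptional⇒special (just z) (inj₂ (inj₂ (inj₁ z²c≡½))) = inj₂ (inj₂ (inj₁ (scaled-square z z²c≡½)))
  exceptional⇒special (just z) (inj₂ (inj₂ (inj₂ z²c≡2))) = inj₂ (inj₂ (inj₂ (scaled-square z z²c≡2)))

  preperiodic⇒special : ∀ {P} → Preperiodic (φ b) P → Special P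
  preperiodic⇒special {P} =
    exceptional⇒special P ∘ ψ-preperiodic⇒exceptional ∘ preperiodic-semiconj π π-semiconj

  φ-on-square : ∀ z k (k≢0 : k ≢ 0ℚ) → z * z ≡ - b * k →
                φ b (just z) ≡ just (z * (1ℚ - 1/_ k {{≢-nonZero k≢0}}))
  φ-on-square z k k≢0 z²≡-bk = φ-just-≡ b z≢0 (begin
    z * (1ℚ - 1/ k) * z          ≡⟨ expand z (1/ k) ⟩
    z * z - (z * z) * 1/ k       ≡⟨ cong (λ r → z * z - r * 1/ k) z²≡-bk ⟩
    z * z - (- b * k) * 1/ k     ≡⟨ regroup (z * z) b k (1/ k) ⟩
    z * z + b * (k * 1/ k)       ≡⟨ cong (λ r → z * z + b * r) (ℚP.*-inverseʳ k) ⟩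
    z * z + b * 1ℚ               ≡⟨ cong (λ r → z * z + r) (ℚP.*-identityʳ b) ⟩
    z * z + b                    ∎)
    where
    instance _ = ≢-nonZero k≢0
    z≢0 : z ≢ 0ℚ
    z≢0 z≡0 = p*q≢0 -b≢0 k≢0 (trans (sym z²≡-bk) (cong (λ r → r * r) z≡0))
    expand : ∀ z i → z * (1ℚ - i) * z ≡ z * z - (z * z) * i
    expand = solve-∀ ℚ-ring
    regroup : ∀ Z b k i → Z - (- b * k) * i ≡ Z + b * (k * i)
    regroup = solve-∀ ℚ-ring

  φ-two-cycle : ∀ z → z * z ≡ - b * ½ → φ b (φ b (just z)) ≡ just z
  φ-two-cycle z z²≡-b/2 = begin
    φ b (φ b (just z))   ≡⟨ cong (φ b) (φ-on-square z ½ (λ ()) z²≡-b/2) ⟩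
    φ b (just (z * - 1ℚ))  ≡⟨ φ-on-square (z * - 1ℚ) ½ (λ ()) (trans (sign-square z) z²≡-b/2) ⟩
    just (z * - 1ℚ * - 1ℚ) ≡⟨ cong just (sign-cancel z) ⟩
    just z               ∎
    where
    sign-square : ∀ z → (z * - 1ℚ) * (z * - 1ℚ) ≡ z * z
    sign-square = solve-∀ ℚ-ring
    sign-cancel : ∀ z → z * - 1ℚ * - 1ℚ ≡ z
    sign-cancel = solve-∀ ℚ-ring

  half-root : ∀ z → z * z ≡ - b * 2ℚ → (z * ½) * (z * ½) ≡ - b * ½
  half-root z z²≡-2b = trans (proj₂ (square-*-square ½ (z , z²≡-2b))) (quarter b)
    where
    quarter : ∀ b → - b * 2ℚ * (½ * ½) ≡ - b * ½
    quarter = solve-∀ ℚ-ring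

  special⇒preperiodic : ∀ P → Special P → Preperiodic (φ b) P
  special⇒preperiodic nothing _ = 1 , 0 , s≤s z≤n , refl
  special⇒preperiodic (just z) (inj₁ refl) = 2 , 1 , s≤s (s≤s z≤n) , refl
  special⇒preperiodic (just z) (inj₂ (inj₁ z²≡-b)) = 3 , 2 , s≤s (s≤s (s≤s z≤n)) ,
    trans (cong (φ b) φ²z≡∞) (sym φ²z≡∞)
    where
    φ²z≡∞ : φ b (φ b (just z)) ≡ nothing
    φ²z≡∞ = cong (φ b) (trans (φ-on-square z 1ℚ (λ ()) z²≡-b) (cong just (ℚP.*-zeroʳ z)))
  special⇒preperiodic (just z) (inj₂ (inj₂ (inj₁ z²≡-b/2))) = 2 , 0 , s≤s z≤n , φ-two-cycle z z²≡-b/2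
  special⇒preperiodic (just z) (inj₂ (inj₂ (inj₂ z²≡-2b))) = 3 , 1 , s≤s (s≤s z≤n) , (begin
    φ b (φ b (φ b (just z)))  ≡⟨ cong (φ b ∘ φ b) φz≡z/2 ⟩
    φ b (φ b (just (z * ½)))  ≡⟨ φ-two-cycle (z * ½) (half-root z z²≡-2b) ⟩
    just (z * ½)              ≡⟨ sym φz≡z/2 ⟩
    φ b (just z)              ∎)
    where
    φz≡z/2 : φ b (just z) ≡ just (z * ½)
    φz≡z/2 = φ-on-square z 2ℚ (λ ()) z²≡-2b

  special⇔preperiodic : ∀ P → Special P ⇔ Preperiodic (φ b) P
  special⇔preperiodic P = mk⇔ (special⇒preperiodic P) preperiodic⇒special

  module SpecialPoints (d₁ : Dec (IsSquare (- b * 1ℚ))) (d₂ : Dec (IsSquare (- b * ½)))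
                       (d₃ : Dec (IsSquare (- b * 2ℚ))) where

    affine-roots : List ℚ
    affine-roots = roots d₁ ++ roots d₂ ++ roots d₃

    ∈-affine-roots : ∀ z → z ∈ affine-roots ⇔ SpecialSquare (z * z)
    ∈-affine-roots z =
      (∈-roots d₁ z ⊎-⇔ ((∈-roots d₂ z ⊎-⇔ ∈-roots d₃ z) ⇔-∘ ∈-++⇔ (roots d₂))) ⇔-∘ ∈-++⇔ (roots d₁)

    affine-root≢0 : ∀ {z} → z ∈ affine-roots → z ≢ 0ℚ
    affine-root≢0 {z} z∈ z≡0 = special-square≢0 (to (∈-affine-roots z) z∈) (cong (λ r → r * r) z≡0)

    affine-roots-unique : Unique affine-roots
    affine-roots-unique = ++⁺ (roots-unique (special-square≢0 (inj₁ refl)) d₁)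
      (++⁺ (roots-unique (special-square≢0 (inj₂ (inj₁ refl))) d₂)
           (roots-unique (special-square≢0 (inj₂ (inj₂ refl))) d₃)
           (roots-disjoint d₂ d₃ ((λ ()) ∘ scale-injective)))
      (λ (z∈₁ , z∈₂₃) → [ (λ z∈₂ → roots-disjoint d₁ d₂ ((λ ()) ∘ scale-injective) (z∈₁ , z∈₂))
                        , (λ z∈₃ → roots-disjoint d₁ d₃ ((λ ()) ∘ scale-injective) (z∈₁ , z∈₃))
                        ]′ (∈-++⁻ (roots d₂) z∈₂₃))

    special-points : List ℙ¹ℚ
    special-points = nothing ∷ just 0ℚ ∷ map just affine-roots

    ∈-special-points : ∀ P → P ∈ special-points ⇔ Special P
    ∈-special-points nothing  = mk⇔ (λ _ → tt) (λ _ → here refl)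
    ∈-special-points (just z) = mk⇔ member⇒special special⇒member
      where
      member⇒special : just z ∈ special-points → Special (just z)
      member⇒special (there (here refl)) = inj₁ refl
      member⇒special (there (there z∈)) with ∈-map⁻ just z∈
      ... | x , x∈ , refl = inj₂ (to (∈-affine-roots x) x∈)
      special⇒member : Special (just z) → just z ∈ special-points
      special⇒member (inj₁ refl)    = there (here refl)
      special⇒member (inj₂ special) = there (there (∈-map⁺ just (from (∈-affine-roots z) special)))

    special-points-unique : Unique special-points
    special-points-unique = tabulate ∞≢ ∷ tabulate 0≢ ∷ map⁺ just-injective affine-roots-unique
      where
      ∞≢ : ∀ {P} → P ∈ just 0ℚ ∷ map just affine-roots → nothing ≢ P
      ∞≢ (here refl) ()
      ∞≢ (there P∈) with ∈-map⁻ just P∈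
      ... | _ , _ , refl = λ ()
      0≢ : ∀ {P} → P ∈ map just affine-roots → just 0ℚ ≢ P
      0≢ P∈ with ∈-map⁻ just P∈
      ... | _ , x∈ , refl = affine-root≢0 x∈ ∘ sym ∘ just-injective

  private
    halve : ∀ b → - b * 1ℚ ≡ - b * ½ * 2ℚ
    halve = solve-∀ ℚ-ring
    quadruple : ∀ b → - b * ½ * (2ℚ * 2ℚ) ≡ - b * 2ℚ
    quadruple = solve-∀ ℚ-ring

    not-both-squares : IsSquare (- b * 1ℚ) → ¬ IsSquare (- b * ½)
    not-both-squares r₁ r₂ = uncurry 2-not-square
      (square-cancelˡ (special-square≢0 (inj₂ (inj₁ refl))) r₂ (subst IsSquare (halve b) r₁))

  length-special-points : ∀ d₁ d₂ d₃ → let n = length (SpecialPoints.special-points d₁ d₂ d₃) in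
                          n ≡ 2 ⊎ n ≡ 4 ⊎ n ≡ 6
  length-special-points (yes r₁) (yes r₂) _        = ⊥-elim (not-both-squares r₁ r₂)
  length-special-points _ (yes r₂) (no ¬r₃)        = ⊥-elim (¬r₃ (subst IsSquare (quadruple b) (square-*-square 2ℚ r₂)))
  length-special-points _ (no ¬r₂) (yes (z , z²≡-2b)) = ⊥-elim (¬r₂ (z * ½ , half-root z z²≡-2b))
  length-special-points (no _)  (no _)  (no _)     = inj₁ refl
  length-special-points (yes _) (no _)  (no _)     = inj₂ (inj₁ refl)
  length-special-points (no _)  (yes _) (yes _)    = inj₂ (inj₂ refl)

corollary4p4 : (b : ℚ) → b ≢ 0ℚ →
    Σ (List ℙ¹ℚ) λ L →
      Unique L
      × (∀ P → (P ∈ L) ⇔ Preperiodic (φ b) P)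
      × (length L ≡ 2 ⊎ length L ≡ 4 ⊎ length L ≡ 6)
corollary4p4 b b≢0 =
    special-points
  , special-points-unique
  , (λ P → special⇔preperiodic P ⇔-∘ ∈-special-points P)
  , length-special-points d₁ d₂ d₃
  where
  open Dynamics b b≢0
  d₁ = square? (- b * 1ℚ)
  d₂ = square? (- b * ½)
  d₃ = square? (- b * 2ℚ)
  open SpecialPoints d₁ d₂ d₃
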